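{- Let $r,s,k,l,m$ be non-negative integers with $m\le r$ and $s=k+l$. Then $$N_{2\times 8}(r,s;m,k,l,0)=N_{2\times 8}(r,s;m,l,k,0).$$
   Context: For non-negative integers $\alpha,\beta,k_0,k_1,k_2,k_3$, $N_{2\times 8}(\alpha,\beta;k_0,k_1,k_2,k_3)=\frac{N_1N_2N_3N_4}{D_1D_2D_3D_4}$ with $N_1=\prod_{i=0}^{k_0-1}((2^{\alpha}-2^{i})2^{\beta})$, $N_2=\prod_{i=0}^{k_1-1}((8^{\beta}-4^{\beta}2^{i})2^{\alpha})$, $N_3=\prod_{i=0}^{k_2-1}((4^{\beta}-2^{\beta+k_1+i})2^{\alpha})$, $N_4=\prod_{i=0}^{k_3-1}(2^{\beta}-2^{k_1+k_2+i})$, $D_1=\prod_{i=0}^{k_0-1}(2^{k_0+k_1+k_2+k_3}-2^{k_1+k_2+k_3+i})$, $D_2=\prod_{i=0}^{k_1-1}((8^{k_1}-4^{k_1}2^{i})2^{k_0+2k_2+k_3})$, $D_3=\prod_{i=0}^{k_2-1}((4^{k_2}-2^{k_2+i})2^{k_0+2k_1+k_3})$, $D_4=\prod_{i=0}^{k_3-1}(2^{k_1+k_2+k_3}-2^{k_1+k_2+i})$; empty products equal $1$. -}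

module Defs where

open import Data.Nat using (ℕ; zero; suc) renaming (_+_ to _+ℕ_; _*_ to _*ℕ_)
open import Data.Integer using (ℤ; +_; +[1+_]; -[1+_]; _-_; _*_; _^_)
open import Data.Rational using (ℚ; _/_; 0ℚ)

prodℤ : ℕ → (ℕ → ℤ) → ℤ
prodℤ zero    f = + 1
prodℤ (suc n) f = prodℤ n f * f n

two^ : ℕ → ℤ
two^ n = (+ 2) ^ n

-- exact rational quotient n/d; the d ≤ 0 branch is never used for N₂ₓ₈,
-- since all denominator factors D₁..D₄ are strictly positive integers.
frac : ℤ → ℤ → ℚ
frac n +[1+ d ] = n / suc d
frac n (+ zero) = 0ℚ
frac n -[1+ d ] = 0ℚ

module _ (α β k₀ k₁ k₂ k₃ : ℕ) where
  N₁ N₂ N₃ N₄ D₁ D₂ D₃ D₄ : ℤ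
  N₁ = prodℤ k₀ (λ i → (two^ α - two^ i) * two^ β)
  N₂ = prodℤ k₁ (λ i → ((+ 8) ^ β - (+ 4) ^ β * two^ i) * two^ α)
  N₃ = prodℤ k₂ (λ i → ((+ 4) ^ β - two^ (β +ℕ k₁ +ℕ i)) * two^ α)
  N₄ = prodℤ k₃ (λ i → two^ β - two^ (k₁ +ℕ k₂ +ℕ i))
  D₁ = prodℤ k₀ (λ i → two^ (k₀ +ℕ k₁ +ℕ k₂ +ℕ k₃) - two^ (k₁ +ℕ k₂ +ℕ k₃ +ℕ i))
  D₂ = prodℤ k₁ (λ i → ((+ 8) ^ k₁ - (+ 4) ^ k₁ * two^ i) * two^ (k₀ +ℕ 2 *ℕ k₂ +ℕ k₃))
  D₃ = prodℤ k₂ (λ i → ((+ 4) ^ k₂ - two^ (k₂ +ℕ i)) * two^ (k₀ +ℕ 2 *ℕ k₁ +ℕ k₃))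
  D₄ = prodℤ k₃ (λ i → two^ (k₁ +ℕ k₂ +ℕ k₃) - two^ (k₁ +ℕ k₂ +ℕ i))

N2×8 : (α β k₀ k₁ k₂ k₃ : ℕ) → ℚ
N2×8 α β k₀ k₁ k₂ k₃ =
  frac (N₁ α β k₀ k₁ k₂ k₃ * N₂ α β k₀ k₁ k₂ k₃ * N₃ α β k₀ k₁ k₂ k₃ * N₄ α β k₀ k₁ k₂ k₃)
       (D₁ α β k₀ k₁ k₂ k₃ * D₂ α β k₀ k₁ k₂ k₃ * D₃ α β k₀ k₁ k₂ k₃ * D₄ α β k₀ k₁ k₂ k₃)

-- Put β = k + l and G n e = ∏_{i<n} (2^e − 2^i). Every factor of N₂, N₃, D₂, D₃ is a power of
-- two times a factor 2^c − 2^i, so for k₃ = 0 the numerator is N₁ · G(k, β) · G(l, l) · 2^a and the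
-- denominator is D₁ · G(k, k) · G(l, l) · 2^b, where N₁ and D₁ are symmetric in k and l. Swapping
-- k and l therefore only replaces G(k, β)/G(k, k) by G(l, β)/G(l, l), which is the symmetry of the
-- Gaussian binomial coefficient [k + l, k]₂ (split G(k + l, k + l) after k or after l factors),
-- and leaves a − b = (r − m)(k + l) unchanged.
module Submission where

open import Defs
open import Data.Nat using (ℕ; _≤_; _+_)
open import Relation.Binary.PropositionalEquality using (_≡_)

open import Data.Nat using (zero; suc; _<_)
import Data.Nat as ℕ
import Data.Nat.Properties as ℕ
import Data.Nat.Tactic.RingSolver as ℕ-Solver
open import Data.List using (_∷_; [])
open import Data.Integer using (ℤ; +_; +[1+_]; _*_; _-_; _^_; NonZero)
import Data.Integer.Properties as ℤ
import Data.Integer.Tactic.RingSolver as ℤ-Solver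
open import Data.Rational.Unnormalised.Base using (mkℚᵘ; *≡*)
import Data.Rational.Properties as ℚ
open import Data.Product using (∃-syntax; _,_)
open import Relation.Binary.PropositionalEquality
  using (refl; sym; trans; cong; cong₂; subst; module ≡-Reasoning)
open ≡-Reasoning

*-interchange : ∀ w x y z → w * x * (y * z) ≡ w * y * (x * z)
*-interchange = ℤ-Solver.solve-∀

factorʳ-minus : ∀ x y z → x * y - x * z ≡ (y - z) * x
factorʳ-minus = ℤ-Solver.solve-∀

prodℤ-cong : ∀ n {f g : ℕ → ℤ} → (∀ i → f i ≡ g i) → prodℤ n f ≡ prodℤ n g
prodℤ-cong zero    f≡g = refl
prodℤ-cong (suc n) f≡g = cong₂ _*_ (prodℤ-cong n f≡g) (f≡g n)

prodℤ-* : ∀ n (f g : ℕ → ℤ) → prodℤ n (λ i → f i * g i) ≡ prodℤ n f * prodℤ n g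
prodℤ-* zero    f g = refl
prodℤ-* (suc n) f g = begin
  prodℤ n (λ i → f i * g i) * (f n * g n)   ≡⟨ cong (_* (f n * g n)) (prodℤ-* n f g) ⟩
  prodℤ n f * prodℤ n g * (f n * g n)       ≡⟨ *-interchange (prodℤ n f) (prodℤ n g) (f n) (g n) ⟩
  prodℤ n f * f n * (prodℤ n g * g n)       ∎

prodℤ-const : ∀ n c → prodℤ n (λ _ → c) ≡ c ^ n
prodℤ-const zero    c = refl
prodℤ-const (suc n) c = trans (cong (_* c) (prodℤ-const n c)) (ℤ.*-comm (c ^ n) c)

prodℤ-+ : ∀ a b (f : ℕ → ℤ) → prodℤ (a + b) f ≡ prodℤ a f * prodℤ b (λ i → f (a + i))
prodℤ-+ a zero    f = trans (cong (λ n → prodℤ n f) (ℕ.+-identityʳ a)) (sym (ℤ.*-identityʳ _))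
prodℤ-+ a (suc b) f = begin
  prodℤ (a + suc b) f                                       ≡⟨ cong (λ n → prodℤ n f) (ℕ.+-suc a b) ⟩
  prodℤ (a + b) f * f (a + b)                               ≡⟨ cong (_* f (a + b)) (prodℤ-+ a b f) ⟩
  prodℤ a f * prodℤ b (λ i → f (a + i)) * f (a + b)          ≡⟨ ℤ.*-assoc (prodℤ a f) _ (f (a + b)) ⟩
  prodℤ a f * (prodℤ b (λ i → f (a + i)) * f (a + b))        ∎

two^-+ : ∀ a b → two^ (a + b) ≡ two^ a * two^ b
two^-+ = ℤ.^-distribˡ-+-* (+ 2)

prodℤ-*-two^ : ∀ n (f : ℕ → ℤ) e → prodℤ n (λ i → f i * two^ e) ≡ prodℤ n f * two^ (e ℕ.* n)
prodℤ-*-two^ n f e = trans (prodℤ-* n f (λ _ → two^ e))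
  (cong (prodℤ n f *_) (trans (prodℤ-const n (two^ e)) (ℤ.^-*-assoc (+ 2) e n)))

independentTuples : ℕ → ℕ → ℤ
independentTuples n e = prodℤ n (λ i → two^ e - two^ i)

independentTuples-+ : ∀ k l →
  independentTuples (k + l) (k + l) ≡ independentTuples k (k + l) * (independentTuples l l * two^ (k ℕ.* l))
independentTuples-+ k l = begin
  independentTuples (k + l) (k + l)                                     ≡⟨ prodℤ-+ k l _ ⟩
  independentTuples k (k + l) * prodℤ l (λ i → two^ (k + l) - two^ (k + i))
    ≡⟨ cong (independentTuples k (k + l) *_) (prodℤ-cong l shift) ⟩
  independentTuples k (k + l) * prodℤ l (λ i → (two^ l - two^ i) * two^ k)
    ≡⟨ cong (independentTuples k (k + l) *_) (prodℤ-*-two^ l _ k) ⟩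
  independentTuples k (k + l) * (independentTuples l l * two^ (k ℕ.* l)) ∎
  where
  shift : ∀ i → two^ (k + l) - two^ (k + i) ≡ (two^ l - two^ i) * two^ k
  shift i rewrite two^-+ k l | two^-+ k i = factorʳ-minus (two^ k) (two^ l) (two^ i)

independentTuples-swap : ∀ k l →
  independentTuples k (k + l) * independentTuples l l ≡ independentTuples l (k + l) * independentTuples k k
independentTuples-swap k l = ℤ.*-cancelʳ-≡ _ _ (two^ (k ℕ.* l)) {{two^-nonZero (k ℕ.* l)}} (begin
  G k (k + l) * G l l * two^ (k ℕ.* l)    ≡⟨ ℤ.*-assoc (G k (k + l)) (G l l) _ ⟩
  G k (k + l) * (G l l * two^ (k ℕ.* l))  ≡⟨ independentTuples-+ k l ⟨
  G (k + l) (k + l)                       ≡⟨ cong (λ n → G n n) (ℕ.+-comm k l) ⟩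
  G (l + k) (l + k)                       ≡⟨ independentTuples-+ l k ⟩
  G l (l + k) * (G k k * two^ (l ℕ.* k))  ≡⟨ cong₂ (λ n e → G l n * (G k k * two^ e)) (ℕ.+-comm l k) (ℕ.*-comm l k) ⟩
  G l (k + l) * (G k k * two^ (k ℕ.* l))  ≡⟨ ℤ.*-assoc (G l (k + l)) (G k k) _ ⟨
  G l (k + l) * G k k * two^ (k ℕ.* l)    ∎)
  where
  G : ℕ → ℕ → ℤ
  G = independentTuples
  two^-nonZero : ∀ n → NonZero (two^ n)
  two^-nonZero zero    = _
  two^-nonZero (suc n) = ℤ.i*j≢0 (+ 2) (two^ n) {{_}} {{two^-nonZero n}}

8^-two^ : ∀ β i → (+ 8) ^ β - (+ 4) ^ β * two^ i ≡ (two^ β - two^ i) * two^ (2 ℕ.* β)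
8^-two^ β i rewrite ℤ.^-*-assoc (+ 2) 3 β | two^-+ β (2 ℕ.* β) | ℤ.^-*-assoc (+ 2) 2 β
  | ℤ.*-comm (two^ β) (two^ (2 ℕ.* β)) = factorʳ-minus (two^ (2 ℕ.* β)) (two^ β) (two^ i)

4^-two^ : ∀ β x c i → 2 ℕ.* β ≡ x + c → (+ 4) ^ β - two^ (x + i) ≡ (two^ c - two^ i) * two^ x
4^-two^ β x c i 2β≡x+c rewrite ℤ.^-*-assoc (+ 2) 2 β | 2β≡x+c | two^-+ x c | two^-+ x i =
  factorʳ-minus (two^ x) (two^ c) (two^ i)

prodℤ-8^-two^ : ∀ n β e →
  prodℤ n (λ i → ((+ 8) ^ β - (+ 4) ^ β * two^ i) * two^ e)
  ≡ independentTuples n β * two^ ((2 ℕ.* β + e) ℕ.* n)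
prodℤ-8^-two^ n β e = trans (prodℤ-cong n factor) (prodℤ-*-two^ n _ (2 ℕ.* β + e))
  where
  factor : ∀ i → ((+ 8) ^ β - (+ 4) ^ β * two^ i) * two^ e ≡ (two^ β - two^ i) * two^ (2 ℕ.* β + e)
  factor i rewrite 8^-two^ β i | two^-+ (2 ℕ.* β) e = ℤ.*-assoc (two^ β - two^ i) (two^ (2 ℕ.* β)) (two^ e)

prodℤ-4^-two^ : ∀ n β x c e → 2 ℕ.* β ≡ x + c →
  prodℤ n (λ i → ((+ 4) ^ β - two^ (x + i)) * two^ e) ≡ independentTuples n c * two^ ((x + e) ℕ.* n)
prodℤ-4^-two^ n β x c e 2β≡x+c = trans (prodℤ-cong n factor) (prodℤ-*-two^ n _ (x + e))
  where
  factor : ∀ i → ((+ 4) ^ β - two^ (x + i)) * two^ e ≡ (two^ c - two^ i) * two^ (x + e)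
  factor i rewrite 4^-two^ β x c i 2β≡x+c | two^-+ x e = ℤ.*-assoc (two^ c - two^ i) (two^ x) (two^ e)

*-regroup : ∀ n a b x y → n * (a * x) * (b * y) * + 1 ≡ n * (a * b) * (x * y)
*-regroup = ℤ-Solver.solve-∀

numeratorExponent : ℕ → ℕ → ℕ → ℕ → ℕ
numeratorExponent α β k₁ k₂ = (2 ℕ.* β + α) ℕ.* k₁ + (β + k₁ + α) ℕ.* k₂

denominatorExponent : ℕ → ℕ → ℕ → ℕ
denominatorExponent k₀ k₁ k₂ = (2 ℕ.* k₁ + (k₀ + 2 ℕ.* k₂ + 0)) ℕ.* k₁ + (k₂ + (k₀ + 2 ℕ.* k₁ + 0)) ℕ.* k₂

exponent-swap : ∀ α k₀ k l →
  numeratorExponent α (k + l) k l + denominatorExponent k₀ l k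
  ≡ numeratorExponent α (k + l) l k + denominatorExponent k₀ k l
exponent-swap = rearrange
  where
  rearrange : ∀ α k₀ k l →
    (2 ℕ.* (k + l) + α) ℕ.* k + (k + l + k + α) ℕ.* l
      + ((2 ℕ.* l + (k₀ + 2 ℕ.* k + 0)) ℕ.* l + (k + (k₀ + 2 ℕ.* l + 0)) ℕ.* k)
    ≡ (2 ℕ.* (k + l) + α) ℕ.* l + (k + l + l + α) ℕ.* k
      + ((2 ℕ.* k + (k₀ + 2 ℕ.* l + 0)) ℕ.* k + (l + (k₀ + 2 ℕ.* k + 0)) ℕ.* l)
  rearrange = ℕ-Solver.solve-∀

numerator-factor : ∀ α β k₀ k₁ k₂ → β ≡ k₁ + k₂ →
  N₁ α β k₀ k₁ k₂ 0 * N₂ α β k₀ k₁ k₂ 0 * N₃ α β k₀ k₁ k₂ 0 * N₄ α β k₀ k₁ k₂ 0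
  ≡ N₁ α β k₀ k₁ k₂ 0 * (independentTuples k₁ β * independentTuples k₂ k₂)
    * two^ (numeratorExponent α β k₁ k₂)
numerator-factor α β k₀ k₁ k₂ refl = begin
  N₁ α β k₀ k₁ k₂ 0 * N₂ α β k₀ k₁ k₂ 0 * N₃ α β k₀ k₁ k₂ 0 * + 1
    ≡⟨ cong₂ (λ x y → N₁ α β k₀ k₁ k₂ 0 * x * y * + 1)
             (prodℤ-8^-two^ k₁ β α) (prodℤ-4^-two^ k₂ β (β + k₁) k₂ α (ℕ-Solver.solve (k₁ ∷ k₂ ∷ []))) ⟩
  N₁ α β k₀ k₁ k₂ 0 * (independentTuples k₁ β * two^ a₁) * (independentTuples k₂ k₂ * two^ a₂) * + 1
    ≡⟨ *-regroup (N₁ α β k₀ k₁ k₂ 0) (independentTuples k₁ β) (independentTuples k₂ k₂) (two^ a₁) (two^ a₂) ⟩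
  N₁ α β k₀ k₁ k₂ 0 * (independentTuples k₁ β * independentTuples k₂ k₂) * (two^ a₁ * two^ a₂)
    ≡⟨ cong (N₁ α β k₀ k₁ k₂ 0 * (independentTuples k₁ β * independentTuples k₂ k₂) *_) (two^-+ a₁ a₂) ⟨
  N₁ α β k₀ k₁ k₂ 0 * (independentTuples k₁ β * independentTuples k₂ k₂) * two^ (a₁ + a₂) ∎
  where
  a₁ a₂ : ℕ
  a₁ = (2 ℕ.* β + α) ℕ.* k₁
  a₂ = (β + k₁ + α) ℕ.* k₂

denominator-factor : ∀ α β k₀ k₁ k₂ →
  D₁ α β k₀ k₁ k₂ 0 * D₂ α β k₀ k₁ k₂ 0 * D₃ α β k₀ k₁ k₂ 0 * D₄ α β k₀ k₁ k₂ 0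
  ≡ D₁ α β k₀ k₁ k₂ 0 * (independentTuples k₁ k₁ * independentTuples k₂ k₂)
    * two^ (denominatorExponent k₀ k₁ k₂)
denominator-factor α β k₀ k₁ k₂ = begin
  D₁ α β k₀ k₁ k₂ 0 * D₂ α β k₀ k₁ k₂ 0 * D₃ α β k₀ k₁ k₂ 0 * + 1
    ≡⟨ cong₂ (λ x y → D₁ α β k₀ k₁ k₂ 0 * x * y * + 1)
             (prodℤ-8^-two^ k₁ k₁ (k₀ + 2 ℕ.* k₂ + 0))
             (prodℤ-4^-two^ k₂ k₂ k₂ k₂ (k₀ + 2 ℕ.* k₁ + 0) (ℕ-Solver.solve (k₂ ∷ []))) ⟩
  D₁ α β k₀ k₁ k₂ 0 * (independentTuples k₁ k₁ * two^ b₁) * (independentTuples k₂ k₂ * two^ b₂) * + 1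
    ≡⟨ *-regroup (D₁ α β k₀ k₁ k₂ 0) (independentTuples k₁ k₁) (independentTuples k₂ k₂) (two^ b₁) (two^ b₂) ⟩
  D₁ α β k₀ k₁ k₂ 0 * (independentTuples k₁ k₁ * independentTuples k₂ k₂) * (two^ b₁ * two^ b₂)
    ≡⟨ cong (D₁ α β k₀ k₁ k₂ 0 * (independentTuples k₁ k₁ * independentTuples k₂ k₂) *_) (two^-+ b₁ b₂) ⟨
  D₁ α β k₀ k₁ k₂ 0 * (independentTuples k₁ k₁ * independentTuples k₂ k₂) * two^ (b₁ + b₂) ∎
  where
  b₁ b₂ : ℕ
  b₁ = (2 ℕ.* k₁ + (k₀ + 2 ℕ.* k₂ + 0)) ℕ.* k₁
  b₂ = (k₂ + (k₀ + 2 ℕ.* k₁ + 0)) ℕ.* k₂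

D₁-swap : ∀ α β k₀ k₁ k₂ k₃ → D₁ α β k₀ k₁ k₂ k₃ ≡ D₁ α β k₀ k₂ k₁ k₃
D₁-swap α β k₀ k₁ k₂ k₃ = prodℤ-cong k₀ λ i →
  cong₂ (λ a b → two^ a - two^ b) total (cong (λ n → n + k₃ + i) (ℕ.+-comm k₁ k₂))
  where
  total : k₀ + k₁ + k₂ + k₃ ≡ k₀ + k₂ + k₁ + k₃
  total = ℕ-Solver.solve (k₀ ∷ k₁ ∷ k₂ ∷ k₃ ∷ [])

Pos : ℤ → Set
Pos x = ∃[ d ] x ≡ +[1+ d ]

Pos-* : ∀ {x y} → Pos x → Pos y → Pos (x * y)
Pos-* (_ , refl) (_ , refl) = _ , refl

two^-pos : ∀ n → Pos (two^ n)
two^-pos zero    = 0 , refl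
two^-pos (suc n) with two^-pos n
... | d , 2ⁿ≡1+d = _ , cong (+ 2 *_) 2ⁿ≡1+d

two^-pred-pos : ∀ c → Pos (two^ (suc c) - + 1)
two^-pred-pos c with two^-pos c
... | d , 2ᶜ≡1+d = _ , trans (cong (λ x → + 2 * x - + 1) 2ᶜ≡1+d) (cong +_ (ℕ.+-suc d (d + 0)))

two^-two^-pos : ∀ {a b} → b < a → Pos (two^ a - two^ b)
two^-two^-pos {b = b} b<a with ℕ.m≤n⇒∃[o]m+o≡n b<a
... | c , refl = subst Pos (sym factor) (Pos-* (two^-pred-pos c) (two^-pos b))
  where
  factor : two^ (suc b + c) - two^ b ≡ (two^ (suc c) - + 1) * two^ b
  factor = begin
    two^ (suc b + c) - two^ b                 ≡⟨ cong₂ _-_ (trans (cong two^ (sym (ℕ.+-suc b c))) (two^-+ b (suc c)))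
                                                            (sym (ℤ.*-identityʳ (two^ b))) ⟩
    two^ b * two^ (suc c) - two^ b * + 1      ≡⟨ factorʳ-minus (two^ b) (two^ (suc c)) (+ 1) ⟩
    (two^ (suc c) - + 1) * two^ b             ∎

prodℤ-pos : ∀ n (f : ℕ → ℤ) → (∀ {i} → i < n → Pos (f i)) → Pos (prodℤ n f)
prodℤ-pos zero    f pos = 0 , refl
prodℤ-pos (suc n) f pos = Pos-* (prodℤ-pos n f (λ i<n → pos (ℕ.m<n⇒m<1+n i<n))) (pos ℕ.≤-refl)

independentTuples-pos : ∀ n → Pos (independentTuples n n)
independentTuples-pos n = prodℤ-pos n _ two^-two^-pos

denominator-pos : ∀ α β k₀ k₁ k₂ k₃ →
  Pos (D₁ α β k₀ k₁ k₂ k₃ * D₂ α β k₀ k₁ k₂ k₃ * D₃ α β k₀ k₁ k₂ k₃ * D₄ α β k₀ k₁ k₂ k₃)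
denominator-pos α β k₀ k₁ k₂ k₃ = Pos-* (Pos-* (Pos-* D₁-pos D₂-pos) D₃-pos) D₄-pos
  where
  D₁-pos : Pos (D₁ α β k₀ k₁ k₂ k₃)
  D₁-pos = prodℤ-pos k₀ _ λ {i} i<k₀ → two^-two^-pos
    (subst (k₁ + k₂ + k₃ + i <_) rotate (ℕ.+-monoʳ-< (k₁ + k₂ + k₃) i<k₀))
    where
    rotate : k₁ + k₂ + k₃ + k₀ ≡ k₀ + k₁ + k₂ + k₃
    rotate = ℕ-Solver.solve (k₀ ∷ k₁ ∷ k₂ ∷ k₃ ∷ [])
  D₂-pos : Pos (D₂ α β k₀ k₁ k₂ k₃)
  D₂-pos = subst Pos (sym (prodℤ-8^-two^ k₁ k₁ (k₀ + 2 ℕ.* k₂ + k₃)))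
    (Pos-* (independentTuples-pos k₁) (two^-pos ((2 ℕ.* k₁ + (k₀ + 2 ℕ.* k₂ + k₃)) ℕ.* k₁)))
  D₃-pos : Pos (D₃ α β k₀ k₁ k₂ k₃)
  D₃-pos = subst Pos (sym (prodℤ-4^-two^ k₂ k₂ k₂ k₂ (k₀ + 2 ℕ.* k₁ + k₃) (ℕ-Solver.solve (k₂ ∷ []))))
    (Pos-* (independentTuples-pos k₂) (two^-pos ((k₂ + (k₀ + 2 ℕ.* k₁ + k₃)) ℕ.* k₂)))
  D₄-pos : Pos (D₄ α β k₀ k₁ k₂ k₃)
  D₄-pos = prodℤ-pos k₃ _ λ i<k₃ → two^-two^-pos (ℕ.+-monoʳ-< (k₁ + k₂) i<k₃)

frac-cross : ∀ {a b c d} → Pos b → Pos d → a * d ≡ c * b → frac a b ≡ frac c d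
frac-cross {a} {_} {c} (b , refl) (d , refl) ad≡cb = ℚ.fromℚᵘ-cong {mkℚᵘ a b} {mkℚᵘ c d} (*≡* ad≡cb)

two^-exchange : ∀ x y {a a′ b b′} → a + b′ ≡ a′ + b →
  x * two^ a * (y * two^ b′) ≡ x * two^ a′ * (y * two^ b)
two^-exchange x y {a} {a′} {b} {b′} a+b′≡a′+b = begin
  x * two^ a * (y * two^ b′)    ≡⟨ *-interchange x (two^ a) y (two^ b′) ⟩
  x * y * (two^ a * two^ b′)    ≡⟨ cong (x * y *_) (trans (sym (two^-+ a b′)) (cong two^ a+b′≡a′+b)) ⟩
  x * y * two^ (a′ + b)         ≡⟨ cong (x * y *_) (two^-+ a′ b) ⟩
  x * y * (two^ a′ * two^ b)    ≡⟨ *-interchange x y (two^ a′) (two^ b) ⟩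
  x * two^ a′ * (y * two^ b)    ∎

lemma3 : (r s k l m : ℕ) → m ≤ r → s ≡ k + l →
    N2×8 r s m k l 0 ≡ N2×8 r s m l k 0
lemma3 r s k l m _ refl = frac-cross (denominator-pos r s m k l 0) (denominator-pos r s m l k 0) (begin
  NL * DR
    ≡⟨ cong₂ _*_ (numerator-factor r s m k l refl) (denominator-factor r s m l k) ⟩
  N * (G k s * G l l) * two^ a * (D₁ r s m l k 0 * (G l l * G k k) * two^ b′)
    ≡⟨ cong₂ (λ D′ P → N * (G k s * G l l) * two^ a * (D′ * P * two^ b′))
             (D₁-swap r s m l k 0) (ℤ.*-comm (G l l) (G k k)) ⟩
  N * (G k s * G l l) * two^ a * (D * (G k k * G l l) * two^ b′)
    ≡⟨ two^-exchange (N * (G k s * G l l)) (D * (G k k * G l l)) {a} {a′} {b} {b′} (exponent-swap r m k l) ⟩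
  N * (G k s * G l l) * two^ a′ * (D * (G k k * G l l) * two^ b)
    ≡⟨ cong (λ P → N * P * two^ a′ * (D * (G k k * G l l) * two^ b)) (independentTuples-swap k l) ⟩
  N * (G l s * G k k) * two^ a′ * (D * (G k k * G l l) * two^ b)
    ≡⟨ cong₂ _*_ (numerator-factor r s m l k (ℕ.+-comm k l)) (denominator-factor r s m k l) ⟨
  NR * DL ∎)
  where
  G : ℕ → ℕ → ℤ
  G = independentTuples
  N D NL NR DL DR : ℤ
  N = N₁ r s m k l 0
  D = D₁ r s m k l 0
  a a′ b b′ : ℕ
  a  = numeratorExponent r s k l
  a′ = numeratorExponent r s l k
  b  = denominatorExponent m k l
  b′ = denominatorExponent m l k
  NL = N₁ r s m k l 0 * N₂ r s m k l 0 * N₃ r s m k l 0 * N₄ r s m k l 0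
  NR = N₁ r s m l k 0 * N₂ r s m l k 0 * N₃ r s m l k 0 * N₄ r s m l k 0
  DL = D₁ r s m k l 0 * D₂ r s m k l 0 * D₃ r s m k l 0 * D₄ r s m k l 0
  DR = D₁ r s m l k 0 * D₂ r s m l k 0 * D₃ r s m l k 0 * D₄ r s m l k 0
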